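{- Let $I$ be an instance of HRC and let $I'$ be the instance of HRC obtained from $I$ by the hospital cloning construction described in the context. Then $I$ admits an MM-stable matching if and only if $I'$ admits an MM-stable matching.
   Context: An instance of HRC consists of residents $R$ and hospitals $H$; residents are single or belong to exactly one couple (an ordered pair $(r_i,r_j)$ of distinct residents). Single residents have strictly ordered preference lists over subsets of $H$; each couple $(r_i,r_j)$ has a strictly ordered joint list over a subset of $H\times H$, where $(h_p,h_q)$ means $r_i\mapsto h_p$, $r_j\mapsto h_q$ is acceptable ($h_p=h_q$ allowed). Each hospital $h_j$ has capacity $c_j\ge1$ and a strictly ordered list over exactly the residents finding it acceptable. A matching $M$: each resident in at most one pair, each hospital $h_j$ in at most $c_j$ pairs, single residents only at acceptable hospitals, each couple either jointly unassigned or assigned to a pair on its list. $M(h)$ = assignees of $h$; under-subscribed means $|M(h)|<$ capacity, full otherwise; unassigned is worse than any acceptable assignment. $M$ is MM-stable if none holds: (1) single $r_i$, acceptable $h_j$, $r_i$ unassigned or preferring $h_j$ to $M(r_i)$, $h_j$ under-subscribed or preferring $r_i$ to some member of $M(h_j)$; (2) couple $(r_i,r_j)$, hospital $h_k$: (a) couple prefers $(h_k,M(r_j))$ to $(M(r_i),M(r_j))$ and $h_k$ under-subscribed or preferring $r_i$ to some member of $M(h_k)\setminus\{r_j\}$, or (b) symmetric with $(M(r_i),h_k)$, $r_j$, $M(h_k)\setminus\{r_i\}$; (3) couple $(r_i,r_j)$, $h_k\ne M(r_i)$, $h_l\ne M(r_j)$, couple prefers $(h_k,h_l)$ to $(M(r_i),M(r_j))$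 and (a) $h_k\ne h_l$ and $h_k$ (resp. $h_l$) under-subscribed or preferring $r_i$ (resp. $r_j$) to at least one assignee; or (b) $h_k=h_l$ with $\ge2$ free posts; or (c) $h_k=h_l$ with exactly one free post, preferring at least one of $r_i,r_j$ to some member of $M(h_k)$; or (d) $h_k=h_l$ full, preferring $r_i$ to some $r_s\in M(h_k)$ and $r_j$ to some $r_t\in M(h_k)\setminus\{r_s\}$. Cloning construction: $I'$ has the same residents and couples as $I$. Each hospital $h_j$ of $I$ is replaced by $c_j$ clones $h_{j,1},\dots,h_{j,c_j}$, each of capacity $1$ with the same preference list as $h_j$. In each single resident's list, each entry $h_j$ is replaced by the sequence $h_{j,1},h_{j,2},\dots,h_{j,c_j}$. In each couple's joint list, each entry $(h_{j_1},h_{j_2})$ with $j_1\ne j_2$ is replaced by the sequence of all pairs $(h_{j_1,a},h_{j_2,b})$, $1\le a\le c_{j_1}$, $1\le b\le c_{j_2}$, ordered first by increasing $b$ and then by increasing $a$; each entry $(h_j,h_j)$ is replaced by the sequence of all pairs $(h_{j,a},h_{j,b})$ with $a\ne b$, $1\le a,b\le c_j$, ordered first by increasing $b$ and then by increasing $a$ (empty if $c_j=1$). The replacement sequences appear in the order of the original entries. -}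

module Defs where

open import Data.Nat using (ℕ; suc; _+_; _≤_; _<_)
open import Data.Fin as Fin using (Fin; toℕ)
open import Data.List using (List; []; _∷_; _++_; map; concatMap; filter; length; allFin)
open import Data.List.Membership.Propositional using (_∈_)
open import Data.List.Relation.Unary.Unique.Propositional using (Unique)
open import Data.Maybe using (Maybe; just; nothing)
open import Data.Maybe.Properties as MaybeP using ()
open import Data.Product using (Σ; ∃; ∃₂; _×_; _,_)
open import Data.Product.Properties as ProdP using ()
open import Data.Sum using (_⊎_; inj₁; inj₂)
open import Relation.Nullary using (¬_; yes; no; ¬?)
open import Relation.Binary.PropositionalEquality using (_≡_; _≢_)
open import Relation.Binary.Definitions using (DecidableEquality)
open import Function.Bundles using (_⇔_)

-- Members of a couple: the couple (r_i , r_j) is an ordered pair;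
-- 'first' is r_i, 'second' is r_j.
data Role : Set where
  first second : Role

Res : ℕ → ℕ → Set
Res ns nc = Fin ns ⊎ (Fin nc × Role)

allRes : (ns nc : ℕ) → List (Res ns nc)
allRes ns nc = map inj₁ (allFin ns)
  ++ concatMap (λ c → inj₂ (c , first) ∷ inj₂ (c , second) ∷ []) (allFin nc)

-- strict preference given by a list: a occurs (strictly) before b
Before : {A : Set} → List A → A → A → Set
Before l a b = ∃₂ λ xs ys → (l ≡ xs ++ (a ∷ ys)) × (b ∈ ys)

-- "the agent prefers acceptable a to its current (possibly absent) assignment m"
-- (being unassigned is worse than any acceptable assignment)
PrefersTo : {A : Set} → List A → A → Maybe A → Set
PrefersTo l a m = (a ∈ l) × ((m ≡ nothing) ⊎ (∃ λ b → (m ≡ just b) × Before l a b))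

record Instance (H : Set) : Set₁ where
  field
    ns nc : ℕ
    sPref : Fin ns → List H
    cPref : Fin nc → List (H × H)
    cap   : H → ℕ
    hPref : H → List (Res ns nc)
open Instance public

module _ {H : Set} (I : Instance H) where
  mem₁ mem₂ : Fin (nc I) → Res (ns I) (nc I)
  mem₁ c = inj₂ (c , first)
  mem₂ c = inj₂ (c , second)

  Acceptable : Res (ns I) (nc I) → H → Set
  Acceptable (inj₁ s) h = h ∈ sPref I s
  Acceptable (inj₂ (c , first)) h = ∃ λ h' → (h , h') ∈ cPref I c
  Acceptable (inj₂ (c , second)) h = ∃ λ h' → (h' , h) ∈ cPref I c

  record Valid : Set where
    field
      sUnique : ∀ s → Unique (sPref I s)
      cUnique : ∀ c → Unique (cPref I c)
      hUnique : ∀ h → Unique (hPref I h)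
      capPos  : ∀ h → 1 ≤ cap I h
      hExact  : ∀ h r → (r ∈ hPref I h) ⇔ Acceptable r h

module Matchings {H : Set} (_≟H_ : DecidableEquality H) (I : Instance H) where
  R = Res (ns I) (nc I)
  Assignment = R → Maybe H

  module _ (M : Assignment) where
    load : H → ℕ
    load h = length (filter (λ r → MaybeP.≡-dec _≟H_ (M r) (just h)) (allRes (ns I) (nc I)))

    Under : H → Set
    Under h = load h < cap I h

    Full : H → Set
    Full h = cap I h ≤ load h

    pairOf : Fin (nc I) → Maybe (H × H)
    pairOf c with M (mem₁ I c) | M (mem₂ I c)
    ... | just a | just b = just (a , b)
    ... | _ | _ = nothing

    IsMatching : Set
    IsMatching =
        (∀ s h → M (inj₁ s) ≡ just h → h ∈ sPref I s)
      × (∀ c → ((M (mem₁ I c) ≡ nothing) × (M (mem₂ I c) ≡ nothing))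
             ⊎ (∃₂ λ h₁ h₂ → (M (mem₁ I c) ≡ just h₁) × (M (mem₂ I c) ≡ just h₂)
                            × ((h₁ , h₂) ∈ cPref I c)))
      × (∀ h → load h ≤ cap I h)

    BP1 : Set
    BP1 = ∃₂ λ s h → PrefersTo (sPref I s) h (M (inj₁ s))
        × (Under h ⊎ (∃ λ r → (M r ≡ just h) × Before (hPref I h) (inj₁ s) r))

    BP2 : Set
    BP2 = ∃₂ λ c hk → ∃₂ λ h₁ h₂ → (M (mem₁ I c) ≡ just h₁) × (M (mem₂ I c) ≡ just h₂)
        × (   (Before (cPref I c) (hk , h₂) (h₁ , h₂)
               × (Under hk ⊎ (∃ λ r → (M r ≡ just hk) × (r ≢ mem₂ I c)
                                      × Before (hPref I hk) (mem₁ I c) r)))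
            ⊎ (Before (cPref I c) (h₁ , hk) (h₁ , h₂)
               × (Under hk ⊎ (∃ λ r → (M r ≡ just hk) × (r ≢ mem₁ I c)
                                      × Before (hPref I hk) (mem₂ I c) r))))

    BP3 : Set
    BP3 = ∃₂ λ c hk → ∃ λ hl → (M (mem₁ I c) ≢ just hk) × (M (mem₂ I c) ≢ just hl)
        × PrefersTo (cPref I c) (hk , hl) (pairOf c)
        × (   ((hk ≢ hl)
               × (Under hk ⊎ (∃ λ r → (M r ≡ just hk) × Before (hPref I hk) (mem₁ I c) r))
               × (Under hl ⊎ (∃ λ r → (M r ≡ just hl) × Before (hPref I hl) (mem₂ I c) r)))
            ⊎ ((hk ≡ hl) × (load hk + 2 ≤ cap I hk))
            ⊎ ((hk ≡ hl) × (suc (load hk) ≡ cap I hk)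
               × (∃ λ r → (M r ≡ just hk)
                    × (Before (hPref I hk) (mem₁ I c) r ⊎ Before (hPref I hk) (mem₂ I c) r)))
            ⊎ ((hk ≡ hl) × Full hk
               × (∃ λ rs → (M rs ≡ just hk) × Before (hPref I hk) (mem₁ I c) rs
                  × (∃ λ rt → (M rt ≡ just hk) × (rt ≢ rs)
                       × Before (hPref I hk) (mem₂ I c) rt))))

    MMStable : Set
    MMStable = IsMatching × ¬ BP1 × ¬ BP2 × ¬ BP3

  HasMMStable : Set
  HasMMStable = ∃ λ (M : Assignment) → MMStable M

module Cloning {H : Set} (_≟H_ : DecidableEquality H) (I : Instance H) where
  CH : Set
  CH = Σ H (λ h → Fin (cap I h))

  _≟CH_ : DecidableEquality CH
  _≟CH_ = ProdP.≡-dec _≟H_ Fin._≟_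

  clones : (h : H) → List CH
  clones h = map (h ,_) (allFin (cap I h))

  -- all (h1,a),(h2,b), ordered by increasing b, then increasing a
  allPairs : H → H → List (CH × CH)
  allPairs h₁ h₂ = concatMap (λ b → map (λ a → ((h₁ , a) , (h₂ , b))) (allFin (cap I h₁)))
                             (allFin (cap I h₂))

  distinctClones : (p : CH × CH) → _
  distinctClones ((_ , a) , (_ , b)) = ¬? (toℕ a Data.Nat.≟ toℕ b)

  expand : H × H → List (CH × CH)
  expand (h₁ , h₂) with h₁ ≟H h₂
  ... | yes _ = filter distinctClones (allPairs h₁ h₂)
  ... | no _  = allPairs h₁ h₂

  clone : Instance CH
  clone = record
    { ns = ns I
    ; nc = nc I
    ; sPref = λ s → concatMap clones (sPref I s)
    ; cPref = λ c → concatMap expand (cPref I c)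
    ; cap = λ _ → 1
    ; hPref = λ { (h , _) → hPref I h }
    }

-- A matching M′ of the cloned instance projects to a matching M of I by forgetting clone
-- indices. The load of h is the sum of the 0/1 loads of its clones, so h has a free post iff
-- some clone is free, and every blocking pair of M lifts to one of M′ through a suitable clone.
-- Conversely, seat the assignees of h in M on h₀, h₁, … in h's order of preference. Every clone
-- below an occupied clone h_y is then held by a resident h prefers to the occupant of h_y, so no
-- blocking pair of the seated matching can use such a lower clone; all others project to blocking
-- pairs of M, except that a type-(3) pair of a couple that keeps one member's hospital projects
-- to a type-(2) pair.

module Submission where

open import Data.Nat as ℕ using (ℕ; zero; suc; _+_; _≤_; _<_; z≤n; s≤s; s≤s⁻¹)
open import Data.Nat.Properties hiding (_≟_)
open import Data.Fin as F using (Fin; toℕ; _≟_)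
import Data.Fin.Properties as FP
open import Data.List using (List; []; _∷_; _++_; map; concatMap; filter; length; allFin; tabulate)
open import Data.List.Properties using (length-++; filter-some; filter-none)
open import Data.List.Membership.Propositional using (_∈_; find; lose)
open import Data.List.Membership.Propositional.Properties
open import Data.List.Relation.Unary.Any using (here; there)
open import Data.List.Relation.Unary.All as All using ([]; _∷_)
open import Data.List.Relation.Unary.Unique.Propositional using (Unique)
open import Data.List.Relation.Unary.AllPairs using ([]; _∷_)
open import Data.Product using (∃; ∃₂; _×_; _,_; proj₁; proj₂)
open import Data.Sum using (_⊎_; inj₁; inj₂)
open import Data.Empty using (⊥; ⊥-elim)
open import Data.Bool using (true; false)
open import Data.Vec.Functional using (Vector)
open import Data.Maybe as Maybe using (Maybe; just; nothing)
import Data.Maybe.Properties as MaybeP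
open import Relation.Nullary using (¬_; Dec; yes; no; does)
open import Relation.Unary using (Decidable)
open import Relation.Binary.PropositionalEquality
open import Relation.Binary.Definitions using (DecidableEquality; tri<; tri≈; tri>)
open import Function.Bundles using (_⇔_; mk⇔; Equivalence)
open import Function.Base using (_∘_; case_of_)
open import Algebra.Properties.CommutativeMonoid.Sum +-0-commutativeMonoid
  using (sum; sum-cong-≗; sum-replicate-zero; ∑-distrib-+)

import Data.List.Relation.Unary.Unique.Propositional.Properties as UP
import Data.Sum.Properties as SumP
import Data.Product.Properties as ProdP

open import Defs

data Precedes {A : Set} : List A → A → A → Set where
  now   : ∀ {a b l} → b ∈ l → Precedes (a ∷ l) a b
  later : ∀ {x a b l} → Precedes l a b → Precedes (x ∷ l) a b

module _ {A : Set} where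

  Before⇒Precedes : ∀ {l : List A} {a b} → Before l a b → Precedes l a b
  Before⇒Precedes ([] , _ , refl , b∈) = now b∈
  Before⇒Precedes (_ ∷ xs , ys , refl , b∈) = later (Before⇒Precedes (xs , ys , refl , b∈))

  Precedes⇒Before : ∀ {l : List A} {a b} → Precedes l a b → Before l a b
  Precedes⇒Before (now {l = l} b∈) = [] , l , refl , b∈
  Precedes⇒Before (later {x = x} p) with Precedes⇒Before p
  ... | xs , ys , refl , b∈ = x ∷ xs , ys , refl , b∈

  Precedes-∈ˡ : ∀ {l : List A} {a b} → Precedes l a b → a ∈ l
  Precedes-∈ˡ (now _) = here refl
  Precedes-∈ˡ (later p) = there (Precedes-∈ˡ p)

  Precedes-∈ʳ : ∀ {l : List A} {a b} → Precedes l a b → b ∈ l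
  Precedes-∈ʳ (now b∈) = there b∈
  Precedes-∈ʳ (later p) = there (Precedes-∈ʳ p)

  Precedes-++⁺ʳ : ∀ (l₁ : List A) {l₂ a b} → Precedes l₂ a b → Precedes (l₁ ++ l₂) a b
  Precedes-++⁺ʳ [] p = p
  Precedes-++⁺ʳ (_ ∷ l₁) p = later (Precedes-++⁺ʳ l₁ p)

  Precedes-++⁺ : ∀ {l₁ l₂ : List A} {a b} → a ∈ l₁ → b ∈ l₂ → Precedes (l₁ ++ l₂) a b
  Precedes-++⁺ {_ ∷ l₁} (here refl) b∈ = now (∈-++⁺ʳ l₁ b∈)
  Precedes-++⁺ (there a∈) b∈ = later (Precedes-++⁺ a∈ b∈)

  Precedes-++⁻ : ∀ (l₁ : List A) {l₂ a b} → Precedes (l₁ ++ l₂) a b →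
                 Precedes l₁ a b ⊎ (a ∈ l₁ × b ∈ l₂) ⊎ Precedes l₂ a b
  Precedes-++⁻ [] p = inj₂ (inj₂ p)
  Precedes-++⁻ (_ ∷ l₁) (now b∈) with ∈-++⁻ l₁ b∈
  ... | inj₁ b∈₁ = inj₁ (now b∈₁)
  ... | inj₂ b∈₂ = inj₂ (inj₁ (here refl , b∈₂))
  Precedes-++⁻ (_ ∷ l₁) (later p) with Precedes-++⁻ l₁ p
  ... | inj₁ q = inj₁ (later q)
  ... | inj₂ (inj₁ (a∈ , b∈)) = inj₂ (inj₁ (there a∈ , b∈))
  ... | inj₂ (inj₂ q) = inj₂ (inj₂ q)

  Precedes-irrefl : ∀ {l : List A} {a} → Unique l → ¬ Precedes l a a
  Precedes-irrefl (a∉ ∷ _) (now a∈) = All.lookup a∉ a∈ refl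
  Precedes-irrefl (_ ∷ u) (later p) = Precedes-irrefl u p

  Precedes-asym : ∀ {l : List A} {a b} → Unique l → Precedes l a b → ¬ Precedes l b a
  Precedes-asym (a∉ ∷ _) (now b∈) (now _) = All.lookup a∉ b∈ refl
  Precedes-asym (a∉ ∷ _) (now _) (later q) = All.lookup a∉ (Precedes-∈ʳ q) refl
  Precedes-asym (b∉ ∷ _) (later p) (now _) = All.lookup b∉ (Precedes-∈ʳ p) refl
  Precedes-asym (_ ∷ u) (later p) (later q) = Precedes-asym u p q

  Precedes-trans : ∀ {l : List A} {a b c} → Unique l → Precedes l a b → Precedes l b c → Precedes l a c
  Precedes-trans _ (now _) (now c∈) = now c∈
  Precedes-trans _ (now _) (later q) = now (Precedes-∈ʳ q)
  Precedes-trans (b∉ ∷ _) (later p) (now _) = ⊥-elim (All.lookup b∉ (Precedes-∈ʳ p) refl)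
  Precedes-trans (_ ∷ u) (later p) (later q) = later (Precedes-trans u p q)

  Precedes-total : ∀ {l : List A} {a b} → a ∈ l → b ∈ l → a ≢ b → Precedes l a b ⊎ Precedes l b a
  Precedes-total (here refl) (here refl) a≢b = ⊥-elim (a≢b refl)
  Precedes-total (here refl) (there b∈) _ = inj₁ (now b∈)
  Precedes-total (there a∈) (here refl) _ = inj₂ (now a∈)
  Precedes-total (there a∈) (there b∈) a≢b with Precedes-total a∈ b∈ a≢b
  ... | inj₁ p = inj₁ (later p)
  ... | inj₂ p = inj₂ (later p)

  Precedes-filter⁻ : ∀ {P : A → Set} (P? : Decidable P) {l a b} →
                     Precedes (filter P? l) a b → Precedes l a b
  Precedes-filter⁻ P? {x ∷ l} p with does (P? x)
  ... | false = later (Precedes-filter⁻ P? p)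
  Precedes-filter⁻ P? {x ∷ l} (now b∈) | true = now (proj₁ (∈-filter⁻ P? b∈))
  Precedes-filter⁻ P? {x ∷ l} (later p) | true = later (Precedes-filter⁻ P? p)

module _ {A B : Set} where

  Precedes-map⁻ : ∀ (f : A → B) {l b b′} → Precedes (map f l) b b′ →
                  ∃₂ λ a a′ → Precedes l a a′ × f a ≡ b × f a′ ≡ b′
  Precedes-map⁻ f {x ∷ _} (now b′∈) with ∈-map⁻ f b′∈
  ... | a′ , a′∈ , refl = x , a′ , now a′∈ , refl , refl
  Precedes-map⁻ f {_ ∷ _} (later p) with Precedes-map⁻ f p
  ... | a , a′ , q , fa , fa′ = a , a′ , later q , fa , fa′

  Precedes-concatMap⁺ : ∀ (f : A → List B) {l a a′ b b′} → Precedes l a a′ →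
                        b ∈ f a → b′ ∈ f a′ → Precedes (concatMap f l) b b′
  Precedes-concatMap⁺ f (now a′∈) b∈ b′∈ = Precedes-++⁺ b∈ (∈-concatMap⁺ f (lose a′∈ b′∈))
  Precedes-concatMap⁺ f {x ∷ _} (later p) b∈ b′∈ = Precedes-++⁺ʳ (f x) (Precedes-concatMap⁺ f p b∈ b′∈)

  Precedes-concatMap⁻ : ∀ (f : A → List B) {l b b′} → Precedes (concatMap f l) b b′ →
     (∃ λ a → Precedes (f a) b b′) ⊎ (∃₂ λ a a′ → Precedes l a a′ × b ∈ f a × b′ ∈ f a′)
  Precedes-concatMap⁻ f {x ∷ l} p with Precedes-++⁻ (f x) p
  ... | inj₁ q = inj₁ (x , q)
  ... | inj₂ (inj₁ (b∈ , b′∈)) with find (∈-concatMap⁻ f {xs = l} b′∈)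
  ...   | a′ , a′∈ , b′∈′ = inj₂ (x , a′ , now a′∈ , b∈ , b′∈′)
  Precedes-concatMap⁻ f {x ∷ l} p | inj₂ (inj₂ q) with Precedes-concatMap⁻ f q
  ... | inj₁ r = inj₁ r
  ... | inj₂ (a , a′ , r , b∈ , b′∈) = inj₂ (a , a′ , later r , b∈ , b′∈)

Precedes-tabulate⁻ : ∀ {A : Set} {n} (g : Fin n → A) {b b′} → Precedes (tabulate g) b b′ →
                     ∃₂ λ i j → i F.< j × g i ≡ b × g j ≡ b′
Precedes-tabulate⁻ {n = suc n} g (now b′∈) with ∈-tabulate⁻ b′∈
... | j , refl = F.zero , F.suc j , s≤s z≤n , refl , refl
Precedes-tabulate⁻ {n = suc n} g (later p) with Precedes-tabulate⁻ (λ i → g (F.suc i)) p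
... | i , j , i<j , refl , refl = F.suc i , F.suc j , s≤s i<j , refl , refl

Precedes-allFin⁻ : ∀ {n} {i j : Fin n} → Precedes (allFin n) i j → i F.< j
Precedes-allFin⁻ p with Precedes-tabulate⁻ (λ i → i) p
... | _ , _ , i<j , refl , refl = i<j

module Rank {A : Set} (_≟A_ : DecidableEquality A) where

  rank : List A → A → ℕ
  rank [] a = 0
  rank (x ∷ l) a with x ≟A a
  ... | yes _ = 0
  ... | no _ = suc (rank l a)

  rank<length : ∀ {l a} → a ∈ l → rank l a < length l
  rank<length {x ∷ l} {a} a∈ with x ≟A a
  ... | yes _ = s≤s z≤n
  rank<length {x ∷ l} {a} (here refl) | no x≢a = ⊥-elim (x≢a refl)
  rank<length {x ∷ l} {a} (there a∈) | no _ = s≤s (rank<length a∈)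

  rank-injective : ∀ {l a b} → a ∈ l → b ∈ l → rank l a ≡ rank l b → a ≡ b
  rank-injective {x ∷ l} {a} {b} a∈ b∈ eq with x ≟A a | x ≟A b
  ... | yes x≡a | yes x≡b = trans (sym x≡a) x≡b
  ... | yes _ | no _ = ⊥-elim (0≢1+n eq)
  ... | no _ | yes _ = ⊥-elim (0≢1+n (sym eq))
  rank-injective {x ∷ l} (here refl) _ eq | no x≢a | no _ = ⊥-elim (x≢a refl)
  rank-injective {x ∷ l} (there _) (here refl) eq | no _ | no x≢b = ⊥-elim (x≢b refl)
  rank-injective {x ∷ l} (there a∈) (there b∈) eq | no _ | no _ = rank-injective a∈ b∈ (suc-injective eq)

  Precedes⇒rank< : ∀ {l a b} → Unique l → Precedes l a b → rank l a < rank l b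
  Precedes⇒rank< {x ∷ l} {a} {b} (x∉ ∷ _) (now b∈) with x ≟A a | x ≟A b
  ... | no x≢a | _ = ⊥-elim (x≢a refl)
  ... | yes _ | yes refl = ⊥-elim (All.lookup x∉ b∈ refl)
  ... | yes _ | no _ = s≤s z≤n
  Precedes⇒rank< {x ∷ l} {a} {b} (x∉ ∷ u) (later p) with x ≟A a | x ≟A b
  ... | yes refl | _ = ⊥-elim (All.lookup x∉ (Precedes-∈ˡ p) refl)
  ... | no _ | yes refl = ⊥-elim (All.lookup x∉ (Precedes-∈ʳ p) refl)
  ... | no _ | no _ = s≤s (Precedes⇒rank< u p)

  rank<⇒Precedes : ∀ {l a b} → Unique l → a ∈ l → b ∈ l → rank l a < rank l b → Precedes l a b
  rank<⇒Precedes u a∈ b∈ lt with Precedes-total a∈ b∈ (λ { refl → <-irrefl refl lt })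
  ... | inj₁ p = p
  ... | inj₂ p = ⊥-elim (<-asym lt (Precedes⇒rank< u p))

  rank-head : ∀ x l → rank (x ∷ l) x ≡ 0
  rank-head x l with x ≟A x
  ... | yes _ = refl
  ... | no x≢x = ⊥-elim (x≢x refl)

  rank-tail : ∀ {x l a} → x ≢ a → rank (x ∷ l) a ≡ suc (rank l a)
  rank-tail {x} {l} {a} x≢a with x ≟A a
  ... | yes x≡a = ⊥-elim (x≢a x≡a)
  ... | no _ = refl

  rank-surjective : ∀ {l} → Unique l → ∀ i → i < length l → ∃ λ a → a ∈ l × rank l a ≡ i
  rank-surjective {x ∷ l} _ zero _ = x , here refl , rank-head x l
  rank-surjective {x ∷ l} (x∉ ∷ u) (suc i) (s≤s lt) with rank-surjective u i lt
  ... | a , a∈ , eq = a , there a∈ , trans (rank-tail (All.lookup x∉ a∈)) (cong suc eq)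

⊆-Unique⇒length≤ : ∀ {A : Set} {xs ys : List A} → Unique xs → (∀ {z} → z ∈ xs → z ∈ ys) →
                   length xs ≤ length ys
⊆-Unique⇒length≤ {xs = []} _ _ = z≤n
⊆-Unique⇒length≤ {xs = x ∷ xs} {ys} (x∉ ∷ u) xs⊆ys with ∈-∃++ (xs⊆ys (here refl))
... | ys₁ , ys₂ , refl = begin
    suc (length xs)                ≤⟨ s≤s (⊆-Unique⇒length≤ u xs⊆ys₁++ys₂) ⟩
    suc (length (ys₁ ++ ys₂))      ≡⟨ cong suc (length-++ ys₁) ⟩
    suc (length ys₁ + length ys₂)  ≡⟨ sym (+-suc (length ys₁) (length ys₂)) ⟩
    length ys₁ + suc (length ys₂)  ≡⟨ sym (length-++ ys₁) ⟩
    length (ys₁ ++ x ∷ ys₂)        ∎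
  where
  open ≤-Reasoning
  xs⊆ys₁++ys₂ : ∀ {z} → z ∈ xs → z ∈ ys₁ ++ ys₂
  xs⊆ys₁++ys₂ z∈ with ∈-++⁻ ys₁ (xs⊆ys (there z∈))
  ... | inj₁ z∈₁ = ∈-++⁺ˡ z∈₁
  ... | inj₂ (here refl) = ⊥-elim (All.lookup x∉ z∈ refl)
  ... | inj₂ (there z∈₂) = ∈-++⁺ʳ ys₁ z∈₂

indicator : ∀ {P : Set} → Dec P → ℕ
indicator (yes _) = 1
indicator (no _) = 0

indicator-yes : ∀ {P : Set} (d : Dec P) → P → indicator d ≡ 1
indicator-yes (yes _) _ = refl
indicator-yes (no ¬p) p = ⊥-elim (¬p p)

indicator-no : ∀ {P : Set} (d : Dec P) → ¬ P → indicator d ≡ 0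
indicator-no (yes p) ¬p = ⊥-elim (¬p p)
indicator-no (no _) _ = refl

module _ {A : Set} {P : A → Set} (P? : Decidable P) where

  length-filter-∷ : ∀ x l → length (filter P? (x ∷ l)) ≡ indicator (P? x) + length (filter P? l)
  length-filter-∷ x l with P? x
  ... | yes _ = refl
  ... | no _ = refl

  length-filter≤1 : ∀ {l} → Unique l → (∀ {x y} → P x → P y → x ≡ y) → length (filter P? l) ≤ 1
  length-filter≤1 {[]} _ _ = z≤n
  length-filter≤1 {x ∷ l} (x∉ ∷ u) P-unique with P? x
  ... | yes px = ≤-reflexive (cong suc (cong length
                   (filter-none P? (All.tabulate λ y∈ py → All.lookup x∉ y∈ (P-unique px py)))))
  ... | no _ = length-filter≤1 u P-unique

module _ {A : Set} {n : ℕ} {P : A → Set} {Q : Fin n → A → Set}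
         (P? : Decidable P) (Q? : ∀ x → Decidable (Q x)) where

  length-filter-∑ : (∀ z → indicator (P? z) ≡ sum (λ x → indicator (Q? x z))) →
                    ∀ l → length (filter P? l) ≡ sum (λ x → length (filter (Q? x) l))
  length-filter-∑ split [] = sym (sum-replicate-zero n)
  length-filter-∑ split (z ∷ l) = begin
    length (filter P? (z ∷ l))
      ≡⟨ length-filter-∷ P? z l ⟩
    indicator (P? z) + length (filter P? l)
      ≡⟨ cong₂ _+_ (split z) (length-filter-∑ split l) ⟩
    sum (λ x → indicator (Q? x z)) + sum (λ x → length (filter (Q? x) l))
      ≡⟨ sym (∑-distrib-+ (λ x → indicator (Q? x z)) (λ x → length (filter (Q? x) l))) ⟩
    sum (λ x → indicator (Q? x z) + length (filter (Q? x) l))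
      ≡⟨ sum-cong-≗ (λ x → sym (length-filter-∷ (Q? x) z l)) ⟩
    sum (λ x → length (filter (Q? x) (z ∷ l)))
      ∎
    where open ≡-Reasoning

∑-zero : ∀ {n} {f : Vector ℕ n} → (∀ i → f i ≡ 0) → sum f ≡ 0
∑-zero {n} f≗0 = trans (sum-cong-≗ f≗0) (sum-replicate-zero n)

∑-point : ∀ {n} (f : Vector ℕ n) (a : Fin n) → f a ≡ 1 → (∀ i → i ≢ a → f i ≡ 0) → sum f ≡ 1
∑-point {suc n} f F.zero fa≡1 rest = cong₂ _+_ fa≡1 (∑-zero (λ i → rest (F.suc i) (λ ())))
∑-point {suc n} f (F.suc a) fa≡1 rest =
  cong₂ _+_ (rest F.zero (λ ()))
            (∑-point (λ i → f (F.suc i)) a fa≡1 (λ i i≢a → rest (F.suc i) (i≢a ∘ FP.suc-injective)))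

∑≤n : ∀ {n} (f : Vector ℕ n) → (∀ i → f i ≤ 1) → sum f ≤ n
∑≤n {zero} f _ = z≤n
∑≤n {suc n} f f≤1 = +-mono-≤ (f≤1 F.zero) (∑≤n (λ i → f (F.suc i)) (λ i → f≤1 (F.suc i)))

∑<n⇒zero : ∀ {n} (f : Vector ℕ n) → sum f < n → ∃ λ i → f i ≡ 0
∑<n⇒zero {suc n} f lt with f F.zero in eq
... | zero = F.zero , eq
... | suc k with ∑<n⇒zero (λ i → f (F.suc i)) (≤-trans (s≤s (m≤n+m _ k)) (s≤s⁻¹ lt))
...   | i , fi≡0 = F.suc i , fi≡0

zero⇒∑<n : ∀ {n} (f : Vector ℕ n) (i : Fin n) → (∀ i → f i ≤ 1) → f i ≡ 0 → sum f < n
zero⇒∑<n {suc n} f F.zero f≤1 f0≡0 rewrite f0≡0 = s≤s (∑≤n (λ i → f (F.suc i)) (λ i → f≤1 (F.suc i)))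
zero⇒∑<n {suc n} f (F.suc i) f≤1 fi≡0 = begin-strict
    f F.zero + rest   <⟨ +-monoʳ-< (f F.zero) (zero⇒∑<n (λ i → f (F.suc i)) i (λ i → f≤1 (F.suc i)) fi≡0) ⟩
    f F.zero + n      ≤⟨ +-monoˡ-≤ n (f≤1 F.zero) ⟩
    suc n             ∎
  where open ≤-Reasoning
        rest : ℕ
        rest = sum (λ i → f (F.suc i))

two-zeros⇒∑+2≤n : ∀ {n} (f : Vector ℕ n) (i j : Fin n) → (∀ i → f i ≤ 1) → i ≢ j →
                   f i ≡ 0 → f j ≡ 0 → sum f + 2 ≤ n
two-zeros⇒∑+2≤n {suc n} f F.zero F.zero _ i≢j _ _ = ⊥-elim (i≢j refl)
two-zeros⇒∑+2≤n {suc n} f F.zero (F.suc j) f≤1 _ f0≡0 fj≡0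
  rewrite f0≡0 | +-comm (sum (λ i → f (F.suc i))) 2 =
  s≤s (zero⇒∑<n (λ i → f (F.suc i)) j (λ i → f≤1 (F.suc i)) fj≡0)
two-zeros⇒∑+2≤n {suc n} f (F.suc i) F.zero f≤1 _ fi≡0 f0≡0
  rewrite f0≡0 | +-comm (sum (λ i → f (F.suc i))) 2 =
  s≤s (zero⇒∑<n (λ i → f (F.suc i)) i (λ i → f≤1 (F.suc i)) fi≡0)
two-zeros⇒∑+2≤n {suc n} f (F.suc i) (F.suc j) f≤1 i≢j fi≡0 fj≡0 = begin
    f F.zero + rest + 2     ≡⟨ +-assoc (f F.zero) rest 2 ⟩
    f F.zero + (rest + 2)   ≤⟨ +-mono-≤ (f≤1 F.zero) (two-zeros⇒∑+2≤n (λ i → f (F.suc i)) i j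
                                 (λ i → f≤1 (F.suc i)) (λ i≡j → i≢j (cong F.suc i≡j)) fi≡0 fj≡0) ⟩
    suc n                   ∎
  where open ≤-Reasoning
        rest : ℕ
        rest = sum (λ i → f (F.suc i))

∑+2≤n⇒two-zeros : ∀ {n} (f : Vector ℕ n) → (∀ i → f i ≤ 1) → sum f + 2 ≤ n →
                   ∃₂ λ i j → i ≢ j × f i ≡ 0 × f j ≡ 0
∑+2≤n⇒two-zeros {suc n} f f≤1 lt with f F.zero in eq | f≤1 F.zero
... | zero | _ with ∑<n⇒zero (λ i → f (F.suc i)) (s≤s⁻¹ (≤-trans (≤-reflexive (+-comm 2 _)) lt))
...   | j , fj≡0 = F.zero , F.suc j , (λ ()) , eq , fj≡0
∑+2≤n⇒two-zeros {suc n} f f≤1 lt | suc zero | _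
  with ∑+2≤n⇒two-zeros (λ i → f (F.suc i)) (λ i → f≤1 (F.suc i)) (s≤s⁻¹ lt)
...   | i , j , i≢j , fi≡0 , fj≡0 = F.suc i , F.suc j , i≢j ∘ FP.suc-injective , fi≡0 , fj≡0
∑+2≤n⇒two-zeros {suc n} f f≤1 lt | suc (suc _) | s≤s ()

_≟Role_ : DecidableEquality Role
first ≟Role first = yes refl
first ≟Role second = no λ ()
second ≟Role first = no λ ()
second ≟Role second = yes refl

module Residents (ns nc : ℕ) where

  _≟R_ : DecidableEquality (Res ns nc)
  _≟R_ = SumP.≡-dec F._≟_ (ProdP.≡-dec F._≟_ _≟Role_)

  private
    members : Fin nc → List (Res ns nc)
    members c = inj₂ (c , first) ∷ inj₂ (c , second) ∷ []

    members⁻ : ∀ {c r} → r ∈ members c → ∃ λ role → r ≡ inj₂ (c , role)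
    members⁻ (here refl) = first , refl
    members⁻ (there (here refl)) = second , refl

    members-unique : ∀ {cs} → Unique cs → Unique (concatMap members cs)
    members-unique {[]} _ = []
    members-unique {c ∷ cs} (c∉ ∷ u) = UP.++⁺ (((λ ()) ∷ []) ∷ [] ∷ []) (members-unique u) disjoint
      where
      disjoint : ∀ {r} → ¬ (r ∈ members c × r ∈ concatMap members cs)
      disjoint (r∈c , r∈cs) with find (∈-concatMap⁻ members {xs = cs} r∈cs)
      ... | c′ , c′∈ , r∈c′ with members⁻ r∈c | members⁻ r∈c′
      ... | _ , refl | _ , refl = All.lookup c∉ c′∈ refl

  ∈-allRes : (r : Res ns nc) → r ∈ allRes ns nc
  ∈-allRes (inj₁ s) = ∈-++⁺ˡ (∈-map⁺ inj₁ (∈-allFin s))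
  ∈-allRes (inj₂ (c , first)) =
    ∈-++⁺ʳ (map inj₁ (allFin ns)) (∈-concatMap⁺ members (lose (∈-allFin c) (here refl)))
  ∈-allRes (inj₂ (c , second)) =
    ∈-++⁺ʳ (map inj₁ (allFin ns)) (∈-concatMap⁺ members (lose (∈-allFin c) (there (here refl))))

  allRes-unique : Unique (allRes ns nc)
  allRes-unique = UP.++⁺ (UP.map⁺ SumP.inj₁-injective (UP.allFin⁺ ns)) (members-unique (UP.allFin⁺ nc)) disjoint
    where
    disjoint : ∀ {r} → ¬ (r ∈ map inj₁ (allFin ns) × r ∈ concatMap members (allFin nc))
    disjoint (r∈singles , r∈couples)
      with ∈-map⁻ inj₁ r∈singles | find (∈-concatMap⁻ members {xs = allFin nc} r∈couples)
    ... | _ , _ , refl | _ , _ , r∈c with members⁻ r∈c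
    ... | _ , ()

module ClonedLists {H : Set} (_≟H_ : DecidableEquality H) (I : Instance H) where
  open Cloning _≟H_ I

  ∈-clones⁻ : ∀ {h c} → c ∈ clones h → proj₁ c ≡ h
  ∈-clones⁻ c∈ with ∈-map⁻ _ c∈
  ... | _ , _ , refl = refl

  ∈-clones⁺ : ∀ {h} (x : Fin (cap I h)) → (h , x) ∈ clones h
  ∈-clones⁺ x = ∈-map⁺ _ (∈-allFin x)

  ∈-cloned⁺ : ∀ {l h} (x : Fin (cap I h)) → h ∈ l → (h , x) ∈ concatMap clones l
  ∈-cloned⁺ x h∈ = ∈-concatMap⁺ clones (lose h∈ (∈-clones⁺ x))

  ∈-cloned⁻ : ∀ {l c} → c ∈ concatMap clones l → proj₁ c ∈ l
  ∈-cloned⁻ {l} c∈ with find (∈-concatMap⁻ clones {xs = l} c∈)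
  ... | _ , h∈ , c∈h rewrite ∈-clones⁻ c∈h = h∈

  Precedes-cloned⁺ : ∀ {l h h′} (x : Fin (cap I h)) (y : Fin (cap I h′)) →
                     Precedes l h h′ → Precedes (concatMap clones l) (h , x) (h′ , y)
  Precedes-cloned⁺ x y p = Precedes-concatMap⁺ clones p (∈-clones⁺ x) (∈-clones⁺ y)

  Precedes-cloned⁻ : ∀ {l h h′} {x : Fin (cap I h)} {y : Fin (cap I h′)} →
                     Precedes (concatMap clones l) (h , x) (h′ , y) →
                     Precedes l h h′ ⊎ (h ≡ h′ × toℕ x < toℕ y)
  Precedes-cloned⁻ {l} p with Precedes-concatMap⁻ clones {l} p
  ... | inj₂ (_ , _ , q , c∈ , c′∈) with ∈-clones⁻ c∈ | ∈-clones⁻ c′∈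
  ...   | refl | refl = inj₁ q
  Precedes-cloned⁻ p | inj₁ (_ , q) with Precedes-map⁻ _ q
  ...   | _ , _ , x<y , refl , refl = inj₂ (refl , Precedes-allFin⁻ x<y)

  ∈-allPairs⁻ : ∀ {h₁ h₂ p} → p ∈ allPairs h₁ h₂ → ∃₂ λ a b → p ≡ ((h₁ , a) , (h₂ , b))
  ∈-allPairs⁻ {h₂ = h₂} p∈ with find (∈-concatMap⁻ _ {xs = allFin (cap I h₂)} p∈)
  ... | b , _ , p∈b with ∈-map⁻ _ p∈b
  ...   | a , _ , refl = a , b , refl

  ∈-allPairs⁺ : ∀ {h₁ h₂} a b → ((h₁ , a) , (h₂ , b)) ∈ allPairs h₁ h₂
  ∈-allPairs⁺ a b = ∈-concatMap⁺ _ (lose (∈-allFin b) (∈-map⁺ _ (∈-allFin a)))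

  ∈-expand⁻ : ∀ {h₁ h₂ p} → p ∈ expand (h₁ , h₂) →
              ∃₂ λ a b → p ≡ ((h₁ , a) , (h₂ , b)) × (h₁ , a) ≢ (h₂ , b)
  ∈-expand⁻ {h₁} {h₂} p∈ with h₁ ≟H h₂
  ... | yes _ with ∈-filter⁻ distinctClones p∈
  ...   | p∈′ , a≢b with ∈-allPairs⁻ p∈′
  ...     | a , b , refl = a , b , refl , λ eq → a≢b (cong (λ c → toℕ (proj₂ c)) eq)
  ∈-expand⁻ {h₁} {h₂} p∈ | no h₁≢h₂ with ∈-allPairs⁻ p∈
  ...   | a , b , refl = a , b , refl , λ eq → h₁≢h₂ (cong proj₁ eq)

  ∈-expand⁺ : ∀ {h₁ h₂} (a : Fin (cap I h₁)) (b : Fin (cap I h₂)) → (h₁ , a) ≢ (h₂ , b) →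
              ((h₁ , a) , (h₂ , b)) ∈ expand (h₁ , h₂)
  ∈-expand⁺ {h₁} {h₂} a b a≢b with h₁ ≟H h₂
  ... | yes refl =
        ∈-filter⁺ distinctClones (∈-allPairs⁺ a b) (λ eq → a≢b (cong (h₁ ,_) (FP.toℕ-injective eq)))
  ... | no _ = ∈-allPairs⁺ a b

  ∈-expanded⁺ : ∀ {l h₁ h₂} (a : Fin (cap I h₁)) (b : Fin (cap I h₂)) → (h₁ , h₂) ∈ l →
                (h₁ , a) ≢ (h₂ , b) → ((h₁ , a) , (h₂ , b)) ∈ concatMap expand l
  ∈-expanded⁺ a b q∈ a≢b = ∈-concatMap⁺ expand (lose q∈ (∈-expand⁺ a b a≢b))

  ∈-expanded⁻ : ∀ {l c₁ c₂} → (c₁ , c₂) ∈ concatMap expand l →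
                (proj₁ c₁ , proj₁ c₂) ∈ l × c₁ ≢ c₂
  ∈-expanded⁻ {l} p∈ with find (∈-concatMap⁻ expand {xs = l} p∈)
  ... | _ , q∈ , p∈q with ∈-expand⁻ p∈q
  ...   | _ , _ , refl , a≢b = q∈ , a≢b

  Precedes-expanded⁻ : ∀ {l h₁ h₂ h₁′ h₂′} {a : Fin (cap I h₁)} {b : Fin (cap I h₂)}
                         {a′ : Fin (cap I h₁′)} {b′ : Fin (cap I h₂′)} →
                       Precedes (concatMap expand l) ((h₁ , a) , (h₂ , b)) ((h₁′ , a′) , (h₂′ , b′)) →
                       Precedes l (h₁ , h₂) (h₁′ , h₂′)
                       ⊎ (h₁ ≡ h₁′ × h₂ ≡ h₂′ × (toℕ b < toℕ b′ ⊎ (toℕ b ≡ toℕ b′ × toℕ a < toℕ a′)))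
  Precedes-expanded⁻ p with Precedes-concatMap⁻ expand p
  ... | inj₂ (_ , _ , q , p∈ , p′∈) with ∈-expand⁻ p∈ | ∈-expand⁻ p′∈
  ...   | _ , _ , refl , _ | _ , _ , refl , _ = inj₁ q
  Precedes-expanded⁻ p | inj₁ ((h₁ , h₂) , q)
    with ∈-expand⁻ (Precedes-∈ˡ q) | ∈-expand⁻ (Precedes-∈ʳ q)
  ... | _ , _ , refl , _ | _ , _ , refl , _ = inj₂ (refl , refl , Precedes-allPairs⁻ (Precedes-block q))
    where
    Precedes-block : ∀ {p p′} → Precedes (expand (h₁ , h₂)) p p′ → Precedes (allPairs h₁ h₂) p p′
    Precedes-block p with h₁ ≟H h₂
    ... | yes _ = Precedes-filter⁻ distinctClones p
    ... | no _ = p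
    Precedes-allPairs⁻ : ∀ {a a′ b b′} →
                         Precedes (allPairs h₁ h₂) ((h₁ , a) , (h₂ , b)) ((h₁ , a′) , (h₂ , b′)) →
                         toℕ b < toℕ b′ ⊎ (toℕ b ≡ toℕ b′ × toℕ a < toℕ a′)
    Precedes-allPairs⁻ p with Precedes-concatMap⁻ _ {allFin (cap I h₂)} p
    ... | inj₁ (_ , q) with Precedes-map⁻ _ q
    ...   | _ , _ , a<a′ , refl , refl = inj₂ (refl , Precedes-allFin⁻ a<a′)
    Precedes-allPairs⁻ p | inj₂ (_ , _ , b<b′ , p∈ , p′∈) with ∈-map⁻ _ p∈ | ∈-map⁻ _ p′∈
    ...   | _ , _ , refl | _ , _ , refl = inj₁ (Precedes-allFin⁻ b<b′)

module CloneLoads {H : Set} (_≟H_ : DecidableEquality H) (I : Instance H) where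
  open Cloning _≟H_ I
  module A = Matchings _≟H_ I
  module B = Matchings _≟CH_ clone

  projectedAt? : ∀ h (m : Maybe CH) → Dec (Maybe.map proj₁ m ≡ just h)
  projectedAt? h m = MaybeP.≡-dec _≟H_ (Maybe.map proj₁ m) (just h)

  at? : ∀ c (m : Maybe CH) → Dec (m ≡ just c)
  at? c m = MaybeP.≡-dec _≟CH_ m (just c)

  indicator-projected : ∀ h m → indicator (projectedAt? h m) ≡ sum (λ x → indicator (at? (h , x) m))
  indicator-projected h nothing = sym (∑-zero {cap I h} (λ _ → refl))
  indicator-projected h (just (h′ , a)) = by-cases (h′ ≟H h)
    where
    by-cases : Dec (h′ ≡ h) →
               indicator (projectedAt? h (just (h′ , a))) ≡ sum (λ x → indicator (at? (h , x) (just (h′ , a))))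
    by-cases (yes refl) = trans (indicator-yes (projectedAt? h (just (h , a))) refl)
      (sym (∑-point _ a (indicator-yes (at? (h , a) (just (h , a))) refl)
                        (λ x x≢a → indicator-no (at? (h , x) (just (h , a))) λ { refl → x≢a refl })))
    by-cases (no h′≢h) = trans (indicator-no (projectedAt? h (just (h′ , a))) λ { refl → h′≢h refl })
      (sym (∑-zero {cap I h} (λ x → indicator-no (at? (h , x) (just (h′ , a))) λ { refl → h′≢h refl })))

  load-∑-clones : (M : A.Assignment) (M′ : B.Assignment) → (∀ r → Maybe.map proj₁ (M′ r) ≡ M r) →
                  ∀ h → A.load M h ≡ sum (λ x → B.load M′ (h , x))
  load-∑-clones M M′ M≡proj h =
    length-filter-∑ (λ r → MaybeP.≡-dec _≟H_ (M r) (just h)) (λ x r → at? (h , x) (M′ r)) split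
      (allRes (ns I) (nc I))
    where
    split : ∀ r → indicator (MaybeP.≡-dec _≟H_ (M r) (just h)) ≡ sum (λ x → indicator (at? (h , x) (M′ r)))
    split r = subst (λ m → indicator (MaybeP.≡-dec _≟H_ m (just h)) ≡ _) (M≡proj r) (indicator-projected h (M′ r))

module MatchingFacts {H : Set} (_≟H_ : DecidableEquality H) (I : Instance H) where
  open Matchings _≟H_ I
  open Residents (ns I) (nc I)

  module _ (M : Assignment) where

    Admits : H → (R → Set) → Set
    Admits h P = Under M h ⊎ ∃ λ r → (M r ≡ just h) × P r

    Admits-map : ∀ {h} {P Q : R → Set} → (∀ {r} → P r → Q r) → Admits h P → Admits h Q
    Admits-map P⇒Q (inj₁ under) = inj₁ under
    Admits-map P⇒Q (inj₂ (r , Mr≡h , pr)) = inj₂ (r , Mr≡h , P⇒Q pr)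

    assigned⇒1≤load : ∀ {r h} → M r ≡ just h → 1 ≤ load M h
    assigned⇒1≤load {r} Mr≡h = filter-some _ (lose (∈-allRes r) Mr≡h)

    pairOf-just⁻ : ∀ c {h₁ h₂} → pairOf M c ≡ just (h₁ , h₂) →
                   M (mem₁ I c) ≡ just h₁ × M (mem₂ I c) ≡ just h₂
    pairOf-just⁻ c _ with M (mem₁ I c) | M (mem₂ I c)
    pairOf-just⁻ c refl | just _ | just _ = refl , refl
    pairOf-just⁻ c () | just _ | nothing
    pairOf-just⁻ c () | nothing | _

    pairOf-just⁺ : ∀ c {h₁ h₂} → M (mem₁ I c) ≡ just h₁ → M (mem₂ I c) ≡ just h₂ →
                   pairOf M c ≡ just (h₁ , h₂)
    pairOf-just⁺ c _ _ with M (mem₁ I c) | M (mem₂ I c)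
    pairOf-just⁺ c refl refl | just _ | just _ = refl

    pairOf-nothing⁺ : ∀ c → M (mem₁ I c) ≡ nothing → pairOf M c ≡ nothing
    pairOf-nothing⁺ c _ with M (mem₁ I c)
    pairOf-nothing⁺ c refl | nothing = refl

    pairOf-nothing⁻ : IsMatching M → ∀ c → pairOf M c ≡ nothing →
                      M (mem₁ I c) ≡ nothing × M (mem₂ I c) ≡ nothing
    pairOf-nothing⁻ (_ , couples , _) c none with couples c
    ... | inj₁ unassigned = unassigned
    ... | inj₂ (_ , _ , M₁≡h₁ , M₂≡h₂ , _) with trans (sym (pairOf-just⁺ c M₁≡h₁ M₂≡h₂)) none
    ...   | ()

module Projection {H : Set} (_≟H_ : DecidableEquality H) (I : Instance H)
         (M′ : Matchings.Assignment (Cloning._≟CH_ _≟H_ I) (Cloning.clone _≟H_ I))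
         (stable′ : Matchings.MMStable (Cloning._≟CH_ _≟H_ I) (Cloning.clone _≟H_ I) M′) where
  open Cloning _≟H_ I
  open ClonedLists _≟H_ I
  open CloneLoads _≟H_ I
  open Residents (ns I) (nc I)
  module FA = MatchingFacts _≟H_ I
  module FB = MatchingFacts _≟CH_ clone
  open FA using (Admits)
  open FB using () renaming (Admits to Admits′)

  M : A.Assignment
  M r = Maybe.map proj₁ (M′ r)

  private
    matching′ : B.IsMatching M′
    matching′ = proj₁ stable′
    no-BP1′ : ¬ B.BP1 M′
    no-BP1′ = proj₁ (proj₂ stable′)
    no-BP2′ : ¬ B.BP2 M′
    no-BP2′ = proj₁ (proj₂ (proj₂ stable′))
    no-BP3′ : ¬ B.BP3 M′
    no-BP3′ = proj₂ (proj₂ (proj₂ stable′))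

  projected : ∀ {r m} → M′ r ≡ m → M r ≡ Maybe.map proj₁ m
  projected = cong (Maybe.map proj₁)

  lift-assigned : ∀ {r h} → M r ≡ just h → ∃ λ x → M′ r ≡ just (h , x)
  lift-assigned {r} _ with M′ r
  lift-assigned refl | just (_ , x) = x , refl

  lift-unassigned : ∀ {r} → M r ≡ nothing → M′ r ≡ nothing
  lift-unassigned {r} _ with M′ r
  lift-unassigned refl | nothing = refl

  load≡∑ : ∀ h → A.load M h ≡ sum (λ x → B.load M′ (h , x))
  load≡∑ = load-∑-clones M M′ (λ _ → refl)

  clone-load≤1 : ∀ c → B.load M′ c ≤ 1
  clone-load≤1 = proj₂ (proj₂ matching′)

  load≡0⇒Under : ∀ {c} → B.load M′ c ≡ 0 → B.Under M′ c
  load≡0⇒Under load≡0 = ≤-reflexive (cong suc load≡0)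

  clone-occupant-unique : ∀ {r r′ c} → M′ r ≡ just c → M′ r′ ≡ just c → r ≡ r′
  clone-occupant-unique {r} {r′} {c} Mr≡c Mr′≡c with r ≟R r′
  ... | yes r≡r′ = r≡r′
  ... | no r≢r′ = ⊥-elim (<-irrefl refl (≤-trans two≤load (clone-load≤1 c)))
    where
    occupants⊆ : ∀ {z} → z ∈ r ∷ r′ ∷ [] →
                 z ∈ filter (λ z → MaybeP.≡-dec _≟CH_ (M′ z) (just c)) (allRes (ns I) (nc I))
    occupants⊆ (here refl) = ∈-filter⁺ _ (∈-allRes r) Mr≡c
    occupants⊆ (there (here refl)) = ∈-filter⁺ _ (∈-allRes r′) Mr′≡c
    two≤load : 2 ≤ B.load M′ c
    two≤load = ⊆-Unique⇒length≤ ((r≢r′ ∷ []) ∷ [] ∷ []) occupants⊆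

  lift-admits : ∀ {h} (P : A.R → Set) → Admits M h P → ∃ λ x → Admits′ M′ (h , x) P
  lift-admits {h} P (inj₁ under) with ∑<n⇒zero _ (subst (_< cap I h) (load≡∑ h) under)
  ... | x , load≡0 = x , inj₁ (load≡0⇒Under load≡0)
  lift-admits P (inj₂ (r , Mr≡h , pr)) with lift-assigned Mr≡h
  ... | x , M′r≡hx = x , inj₂ (r , M′r≡hx , pr)

  admits-other⇒≢ : ∀ {c c′} r′ (Q : A.R → Set) → M′ r′ ≡ just c′ →
                   Admits′ M′ c (λ r → r ≢ r′ × Q r) → c ≢ c′
  admits-other⇒≢ r′ Q M′r′≡c′ (inj₁ under) refl =
    <-irrefl refl (≤-trans (FB.assigned⇒1≤load M′ M′r′≡c′) (≤-reflexive (n<1⇒n≡0 under)))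
  admits-other⇒≢ r′ Q M′r′≡c′ (inj₂ (r , M′r≡c , r≢r′ , _)) refl =
    r≢r′ (clone-occupant-unique M′r≡c M′r′≡c′)

  couple-clones-expanded : ∀ c {c₁ c₂} → M′ (mem₁ I c) ≡ just c₁ → M′ (mem₂ I c) ≡ just c₂ →
                           (c₁ , c₂) ∈ expand (proj₁ c₁ , proj₁ c₂)
  couple-clones-expanded c M′₁≡c₁ M′₂≡c₂ with proj₁ (proj₂ matching′) c
  ... | inj₁ (M′₁≡nothing , _) with trans (sym M′₁≡c₁) M′₁≡nothing
  ...   | ()
  couple-clones-expanded c M′₁≡c₁ M′₂≡c₂ | inj₂ (_ , _ , M′₁≡ , M′₂≡ , p∈)
    with trans (sym M′₁≡c₁) M′₁≡ | trans (sym M′₂≡c₂) M′₂≡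
  ... | refl | refl = ∈-expand⁺ _ _ (proj₂ (∈-expanded⁻ {cPref I c} p∈))

  lift-single-prefers : ∀ s {h} (x : Fin (cap I h)) → PrefersTo (sPref I s) h (M (inj₁ s)) →
                        PrefersTo (sPref clone s) (h , x) (M′ (inj₁ s))
  lift-single-prefers s x (h∈ , inj₁ unassigned) = ∈-cloned⁺ x h∈ , inj₁ (lift-unassigned unassigned)
  lift-single-prefers s x (h∈ , inj₂ (h′ , Ms≡h′ , h<h′)) with lift-assigned Ms≡h′
  ... | y , M′s≡h′y = ∈-cloned⁺ x h∈ ,
        inj₂ ((h′ , y) , M′s≡h′y , Precedes⇒Before (Precedes-cloned⁺ x y (Before⇒Precedes h<h′)))

  lift-couple-precedes : ∀ c {hk hl} (x : Fin (cap I hk)) (y : Fin (cap I hl)) {c₁ c₂} → (hk , x) ≢ (hl , y) →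
                         M′ (mem₁ I c) ≡ just c₁ → M′ (mem₂ I c) ≡ just c₂ →
                         Before (cPref I c) (hk , hl) (proj₁ c₁ , proj₁ c₂) →
                         Before (cPref clone c) ((hk , x) , (hl , y)) (c₁ , c₂)
  lift-couple-precedes c x y x≢y M′₁≡c₁ M′₂≡c₂ better =
    Precedes⇒Before (Precedes-concatMap⁺ expand (Before⇒Precedes better) (∈-expand⁺ x y x≢y)
                                        (couple-clones-expanded c M′₁≡c₁ M′₂≡c₂))

  lift-couple-prefers : ∀ c {hk hl} (x : Fin (cap I hk)) (y : Fin (cap I hl)) → (hk , x) ≢ (hl , y) →
                        PrefersTo (cPref I c) (hk , hl) (A.pairOf M c) →
                        PrefersTo (cPref clone c) ((hk , x) , (hl , y)) (B.pairOf M′ c)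
  lift-couple-prefers c {hk} {hl} x y x≢y (q∈ , current) = ∈-expanded⁺ x y q∈ x≢y , lift current
    where
    projected-pair : ∀ {c₁ c₂} → M′ (mem₁ I c) ≡ just c₁ → M′ (mem₂ I c) ≡ just c₂ →
                     A.pairOf M c ≡ just (proj₁ c₁ , proj₁ c₂)
    projected-pair M′₁≡c₁ M′₂≡c₂ = FA.pairOf-just⁺ M c (projected M′₁≡c₁) (projected M′₂≡c₂)
    lift : (A.pairOf M c ≡ nothing) ⊎ (∃ λ q → A.pairOf M c ≡ just q × Before (cPref I c) (hk , hl) q) →
           (B.pairOf M′ c ≡ nothing)
             ⊎ (∃ λ q′ → B.pairOf M′ c ≡ just q′ × Before (cPref clone c) ((hk , x) , (hl , y)) q′)
    lift current with B.pairOf M′ c in pair′≡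
    ... | nothing = inj₁ refl
    ... | just (c₁ , c₂) with M′₁≡c₁ , M′₂≡c₂ ← FB.pairOf-just⁻ M′ c pair′≡ | current
    ...   | inj₁ unassigned with () ← trans (sym (projected-pair M′₁≡c₁ M′₂≡c₂)) unassigned
    ...   | inj₂ (_ , pair≡q , better) with refl ← trans (sym (projected-pair M′₁≡c₁ M′₂≡c₂)) pair≡q =
            inj₂ ((c₁ , c₂) , refl , lift-couple-precedes c x y x≢y M′₁≡c₁ M′₂≡c₂ better)

  matching : A.IsMatching M
  matching = singles , couples , loads
    where
    singles : ∀ s h → M (inj₁ s) ≡ just h → h ∈ sPref I s
    singles s h Ms≡h with lift-assigned Ms≡h
    ... | x , M′s≡hx = ∈-cloned⁻ (proj₁ matching′ s (h , x) M′s≡hx)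
    couples : ∀ c → ((M (mem₁ I c) ≡ nothing) × (M (mem₂ I c) ≡ nothing))
                  ⊎ (∃₂ λ h₁ h₂ → (M (mem₁ I c) ≡ just h₁) × (M (mem₂ I c) ≡ just h₂)
                                 × ((h₁ , h₂) ∈ cPref I c))
    couples c with proj₁ (proj₂ matching′) c
    ... | inj₁ (M′₁≡nothing , M′₂≡nothing) = inj₁ (projected M′₁≡nothing , projected M′₂≡nothing)
    ... | inj₂ (c₁ , c₂ , M′₁≡c₁ , M′₂≡c₂ , p∈) =
          inj₂ (proj₁ c₁ , proj₁ c₂ , projected M′₁≡c₁ , projected M′₂≡c₂ ,
                proj₁ (∈-expanded⁻ {cPref I c} p∈))
    loads : ∀ h → A.load M h ≤ cap I h
    loads h = subst (_≤ cap I h) (sym (load≡∑ h)) (∑≤n _ (λ x → clone-load≤1 (h , x)))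

  no-BP1 : ¬ A.BP1 M
  no-BP1 (s , h , prefers , admits) with lift-admits _ admits
  ... | x , admits′ = no-BP1′ (s , (h , x) , lift-single-prefers s x prefers , admits′)

  no-BP2 : ¬ A.BP2 M
  no-BP2 (c , hk , h₁ , h₂ , M₁≡h₁ , M₂≡h₂ , which)
    with a , M′₁≡h₁a ← lift-assigned M₁≡h₁ | b , M′₂≡h₂b ← lift-assigned M₂≡h₂ | which
  ... | inj₁ (better , admits) with x , admits′ ← lift-admits _ admits =
    no-BP2′ (c , (hk , x) , (h₁ , a) , (h₂ , b) , M′₁≡h₁a , M′₂≡h₂b ,
             inj₁ (lift-couple-precedes c x b x≢b M′₁≡h₁a M′₂≡h₂b better , admits′))
    where
    x≢b : (hk , x) ≢ (h₂ , b)
    x≢b = admits-other⇒≢ (mem₂ I c) _ M′₂≡h₂b admits′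
  ... | inj₂ (better , admits) with x , admits′ ← lift-admits _ admits =
    no-BP2′ (c , (hk , x) , (h₁ , a) , (h₂ , b) , M′₁≡h₁a , M′₂≡h₂b ,
             inj₂ (lift-couple-precedes c a x a≢x M′₁≡h₁a M′₂≡h₂b better , admits′))
    where
    a≢x : (h₁ , a) ≢ (hk , x)
    a≢x = admits-other⇒≢ (mem₁ I c) _ M′₁≡h₁a admits′ ∘ sym

  occupied≢free : ∀ {r c c′} → M′ r ≡ just c → B.load M′ c′ ≡ 0 → c ≢ c′
  occupied≢free M′r≡c load≡0 refl =
    <-irrefl refl (≤-trans (FB.assigned⇒1≤load M′ M′r≡c) (≤-reflexive load≡0))

  clone-BP3 : ∀ c {hk hl} (x : Fin (cap I hk)) (y : Fin (cap I hl)) →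
              M (mem₁ I c) ≢ just hk → M (mem₂ I c) ≢ just hl →
              PrefersTo (cPref I c) (hk , hl) (A.pairOf M c) → (hk , x) ≢ (hl , y) →
              Admits′ M′ (hk , x) (Before (hPref I hk) (mem₁ I c)) →
              Admits′ M′ (hl , y) (Before (hPref I hl) (mem₂ I c)) → B.BP3 M′
  clone-BP3 c x y M₁≢hk M₂≢hl prefers x≢y admits₁ admits₂ =
    c , _ , _ , M₁≢hk ∘ projected , M₂≢hl ∘ projected ,
    lift-couple-prefers c x y x≢y prefers , inj₁ (x≢y , admits₁ , admits₂)

  no-BP3 : ¬ A.BP3 M
  no-BP3 (c , hk , hl , M₁≢hk , M₂≢hl , prefers , inj₁ (hk≢hl , admits₁ , admits₂))
    with x , admits₁′ ← lift-admits _ admits₁ | y , admits₂′ ← lift-admits _ admits₂ =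
    no-BP3′ (clone-BP3 c x y M₁≢hk M₂≢hl prefers (λ eq → hk≢hl (cong proj₁ eq)) admits₁′ admits₂′)
  no-BP3 (c , hk , _ , M₁≢hk , M₂≢hk , prefers , inj₂ (inj₁ (refl , two-free)))
    with x , y , x≢y , load₁≡0 , load₂≡0 ← ∑+2≤n⇒two-zeros _ (λ x → clone-load≤1 (hk , x))
                                              (subst (λ n → n + 2 ≤ cap I hk) (load≡∑ hk) two-free) =
    no-BP3′ (clone-BP3 c x y M₁≢hk M₂≢hk prefers (λ { refl → x≢y refl })
                       (inj₁ (load≡0⇒Under load₁≡0)) (inj₁ (load≡0⇒Under load₂≡0)))
  no-BP3 (c , hk , _ , M₁≢hk , M₂≢hk , prefers , inj₂ (inj₂ (inj₁ (refl , one-free , r , Mr≡hk , worse))))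
    with f , load≡0 ← ∑<n⇒zero _ (≤-reflexive (trans (cong suc (sym (load≡∑ hk))) one-free))
       | z , M′r≡hkz ← lift-assigned Mr≡hk | worse
  ... | inj₁ r<₁ = no-BP3′ (clone-BP3 c z f M₁≢hk M₂≢hk prefers (occupied≢free M′r≡hkz load≡0)
                                      (inj₂ (r , M′r≡hkz , r<₁)) (inj₁ (load≡0⇒Under load≡0)))
  ... | inj₂ r<₂ = no-BP3′ (clone-BP3 c f z M₁≢hk M₂≢hk prefers (occupied≢free M′r≡hkz load≡0 ∘ sym)
                                      (inj₁ (load≡0⇒Under load≡0)) (inj₂ (r , M′r≡hkz , r<₂)))
  no-BP3 (c , hk , _ , M₁≢hk , M₂≢hk , prefers ,
          inj₂ (inj₂ (inj₂ (refl , _ , rs , Mrs≡hk , rs<₁ , rt , Mrt≡hk , rt≢rs , rt<₂))))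
    with zs , M′rs≡ ← lift-assigned Mrs≡hk | zt , M′rt≡ ← lift-assigned Mrt≡hk =
    no-BP3′ (clone-BP3 c zs zt M₁≢hk M₂≢hk prefers
                       (λ eq → rt≢rs (clone-occupant-unique M′rt≡ (trans M′rs≡ (cong just eq))))
                       (inj₂ (rs , M′rs≡ , rs<₁)) (inj₂ (rt , M′rt≡ , rt<₂)))

  stable : A.MMStable M
  stable = matching , no-BP1 , no-BP2 , no-BP3

module Seating {H : Set} (_≟H_ : DecidableEquality H) (I : Instance H) (V : Valid I)
         (M : Matchings.Assignment _≟H_ I) (stable : Matchings.MMStable _≟H_ I M) where
  open Cloning _≟H_ I
  open ClonedLists _≟H_ I
  open CloneLoads _≟H_ I
  open Residents (ns I) (nc I)
  open Rank _≟R_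
  open Valid V
  module FA = MatchingFacts _≟H_ I
  module FB = MatchingFacts _≟CH_ clone
  open FA using (Admits)
  open FB using () renaming (Admits to Admits′)

  private
    matching : A.IsMatching M
    matching = proj₁ stable
    no-BP1 : ¬ A.BP1 M
    no-BP1 = proj₁ (proj₂ stable)
    no-BP2 : ¬ A.BP2 M
    no-BP2 = proj₁ (proj₂ (proj₂ stable))
    no-BP3 : ¬ A.BP3 M
    no-BP3 = proj₂ (proj₂ (proj₂ stable))

  assigned⇒acceptable : ∀ {r h} → M r ≡ just h → r ∈ hPref I h
  assigned⇒acceptable {inj₁ s} {h} Mr≡h = Equivalence.from (hExact h (inj₁ s)) (proj₁ matching s h Mr≡h)
  assigned⇒acceptable {inj₂ (c , role)} {h} Mr≡h with proj₁ (proj₂ matching) c | role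
  ... | inj₁ (M₁≡nothing , _) | first with () ← trans (sym Mr≡h) M₁≡nothing
  ... | inj₁ (_ , M₂≡nothing) | second with () ← trans (sym Mr≡h) M₂≡nothing
  ... | inj₂ (_ , h₂ , M₁≡h₁ , _ , q∈) | first with refl ← trans (sym Mr≡h) M₁≡h₁ =
        Equivalence.from (hExact h (mem₁ I c)) (h₂ , q∈)
  ... | inj₂ (h₁ , _ , _ , M₂≡h₂ , q∈) | second with refl ← trans (sym Mr≡h) M₂≡h₂ =
        Equivalence.from (hExact h (mem₂ I c)) (h₁ , q∈)

  assignedTo? : ∀ h → Decidable (λ r → M r ≡ just h)
  assignedTo? h r = MaybeP.≡-dec _≟H_ (M r) (just h)

  assignees : H → List A.R
  assignees h = filter (assignedTo? h) (hPref I h)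

  assignees-unique : ∀ h → Unique (assignees h)
  assignees-unique h = UP.filter⁺ (assignedTo? h) (hUnique h)

  ∈-assignees⁺ : ∀ {r h} → M r ≡ just h → r ∈ assignees h
  ∈-assignees⁺ {h = h} Mr≡h = ∈-filter⁺ (assignedTo? h) (assigned⇒acceptable Mr≡h) Mr≡h

  ∈-assignees⁻ : ∀ {r h} → r ∈ assignees h → M r ≡ just h
  ∈-assignees⁻ {h = h} r∈ = proj₂ (∈-filter⁻ (assignedTo? h) {xs = hPref I h} r∈)

  length-assignees≤cap : ∀ h → length (assignees h) ≤ cap I h
  length-assignees≤cap h =
    ≤-trans (⊆-Unique⇒length≤ (assignees-unique h) (λ {r} r∈ → ∈-filter⁺ _ (∈-allRes r) (∈-assignees⁻ r∈)))
            (proj₂ (proj₂ matching) h)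

  -- The fallback nothing is unreachable: rank < |M(h)| ≤ cap h.
  seat : A.R → Maybe H → Maybe CH
  seat r nothing = nothing
  seat r (just h) with rank (assignees h) r ℕ.<? cap I h
  ... | yes i<cap = just (h , F.fromℕ< i<cap)
  ... | no _ = nothing

  M′ : B.Assignment
  M′ r = seat r (M r)

  rank<cap : ∀ {r h} → M r ≡ just h → rank (assignees h) r < cap I h
  rank<cap {h = h} Mr≡h = <-≤-trans (rank<length (∈-assignees⁺ Mr≡h)) (length-assignees≤cap h)

  seat-just⁻ : ∀ r m {h x} → seat r m ≡ just (h , x) → m ≡ just h × toℕ x ≡ rank (assignees h) r
  seat-just⁻ r (just h) _ with rank (assignees h) r ℕ.<? cap I h
  seat-just⁻ r (just h) refl | yes i<cap = refl , FP.toℕ-fromℕ< i<cap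

  seat-just⁺ : ∀ r h → rank (assignees h) r < cap I h → ∃ λ x → seat r (just h) ≡ just (h , x)
  seat-just⁺ r h i<cap with rank (assignees h) r ℕ.<? cap I h
  ... | yes i<cap′ = F.fromℕ< i<cap′ , refl
  ... | no i≮cap = ⊥-elim (i≮cap i<cap)

  M′-just⁻ : ∀ {r h x} → M′ r ≡ just (h , x) → M r ≡ just h × toℕ x ≡ rank (assignees h) r
  M′-just⁻ {r} = seat-just⁻ r (M r)

  M′-just⁺ : ∀ {r h} → M r ≡ just h → ∃ λ x → M′ r ≡ just (h , x)
  M′-just⁺ {r} {h} Mr≡h =
    subst (λ m → ∃ λ x → seat r m ≡ just (h , x)) (sym Mr≡h) (seat-just⁺ r h (rank<cap Mr≡h))

  M′-nothing : ∀ {r} → M r ≡ nothing → M′ r ≡ nothing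
  M′-nothing {r} Mr≡nothing = cong (seat r) Mr≡nothing

  projection : ∀ r → Maybe.map proj₁ (M′ r) ≡ M r
  projection r with M r in Mr≡
  ... | nothing = refl
  ... | just h with seat-just⁺ r h (rank<cap Mr≡)
  ...   | _ , seated = cong (Maybe.map proj₁) seated

  seated⇒assigned : ∀ {r c} → M′ r ≡ just c → M r ≡ just (proj₁ c)
  seated⇒assigned M′r≡c = proj₁ (M′-just⁻ M′r≡c)

  unseated⇒unassigned : ∀ {r} → M′ r ≡ nothing → M r ≡ nothing
  unseated⇒unassigned {r} M′r≡nothing = trans (sym (projection r)) (cong (Maybe.map proj₁) M′r≡nothing)

  load≡∑ : ∀ h → A.load M h ≡ sum (λ x → B.load M′ (h , x))
  load≡∑ = load-∑-clones M M′ projection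

  seat-occupant-unique : ∀ {r r′ c} → M′ r ≡ just c → M′ r′ ≡ just c → r ≡ r′
  seat-occupant-unique M′r≡c M′r′≡c
    with Mr≡h , x≡rank ← M′-just⁻ M′r≡c | Mr′≡h , x≡rank′ ← M′-just⁻ M′r′≡c =
    rank-injective (∈-assignees⁺ Mr≡h) (∈-assignees⁺ Mr′≡h) (trans (sym x≡rank) x≡rank′)

  clone-load≤1 : ∀ c → B.load M′ c ≤ 1
  clone-load≤1 c = length-filter≤1 _ allRes-unique seat-occupant-unique

  seated-below-length : ∀ {r h y} → M′ r ≡ just (h , y) → toℕ y < length (assignees h)
  seated-below-length M′r≡hy with Mr≡h , y≡rank ← M′-just⁻ M′r≡hy rewrite y≡rank =
    rank<length (∈-assignees⁺ Mr≡h)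

  low-clone-occupied : ∀ {h} (x : Fin (cap I h)) → toℕ x < length (assignees h) →
                       ∃ λ r → M′ r ≡ just (h , x)
  low-clone-occupied {h} x x<len with r , r∈ , rank≡x ← rank-surjective (assignees-unique h) (toℕ x) x<len
                                  with x′ , M′r≡hx′ ← M′-just⁺ (∈-assignees⁻ r∈)
                                  with _ , x′≡rank ← M′-just⁻ M′r≡hx′
                                  rewrite FP.toℕ-injective {i = x′} {j = x} (trans x′≡rank rank≡x) = r , M′r≡hx′

  free-clone-above : ∀ {h x} → B.Under M′ (h , x) → length (assignees h) ≤ toℕ x
  free-clone-above {h} {x} under with toℕ x ℕ.<? length (assignees h)
  ... | no x≮len = ≮⇒≥ x≮len
  ... | yes x<len with r , M′r≡hx ← low-clone-occupied x x<len =
        ⊥-elim (<-irrefl refl (≤-trans (FB.assigned⇒1≤load M′ M′r≡hx) (≤-reflexive (n<1⇒n≡0 under))))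

  seat-order : ∀ {r s h x y} → M′ r ≡ just (h , x) → M′ s ≡ just (h , y) → toℕ x < toℕ y →
               Precedes (hPref I h) r s
  seat-order {h = h} M′r≡hx M′s≡hy x<y
    with Mr≡h , x≡rank ← M′-just⁻ M′r≡hx | Ms≡h , y≡rank ← M′-just⁻ M′s≡hy rewrite x≡rank | y≡rank =
    Precedes-filter⁻ (assignedTo? h)
      (rank<⇒Precedes (assignees-unique h) (∈-assignees⁺ Mr≡h) (∈-assignees⁺ Ms≡h) x<y)

  lower-clone-rejects : ∀ {h r} (x y : Fin (cap I h)) → M′ r ≡ just (h , y) → toℕ x < toℕ y →
                        ¬ Admits′ M′ (h , x) (Before (hPref I h) r)
  lower-clone-rejects x y M′r≡hy x<y (inj₁ under) =
    <-irrefl refl (<-≤-trans (<-trans x<y (seated-below-length M′r≡hy)) (free-clone-above under))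
  lower-clone-rejects {h} x y M′r≡hy x<y (inj₂ (s , M′s≡hx , r<s)) =
    Precedes-asym (hUnique h) (Before⇒Precedes r<s) (seat-order M′s≡hx M′r≡hy x<y)

  free-clone⇒Under : ∀ {h x} → B.Under M′ (h , x) → A.Under M h
  free-clone⇒Under {h} {x} under = subst (_< cap I h) (sym (load≡∑ h))
    (zero⇒∑<n _ x (λ x → clone-load≤1 (h , x)) (n<1⇒n≡0 under))

  project-admits : ∀ {h x} (P : A.R → Set) → Admits′ M′ (h , x) P → Admits M h P
  project-admits P (inj₁ under) = inj₁ (free-clone⇒Under under)
  project-admits P (inj₂ (r , M′r≡hx , pr)) = inj₂ (r , proj₁ (M′-just⁻ M′r≡hx) , pr)

  matching′ : B.IsMatching M′
  matching′ = singles , couples , clone-load≤1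
    where
    singles : ∀ s c → M′ (inj₁ s) ≡ just c → c ∈ concatMap clones (sPref I s)
    singles s (h , x) M′s≡hx = ∈-cloned⁺ x (proj₁ matching s h (proj₁ (M′-just⁻ M′s≡hx)))
    couples : ∀ c → ((M′ (mem₁ I c) ≡ nothing) × (M′ (mem₂ I c) ≡ nothing))
                  ⊎ (∃₂ λ c₁ c₂ → (M′ (mem₁ I c) ≡ just c₁) × (M′ (mem₂ I c) ≡ just c₂)
                                 × ((c₁ , c₂) ∈ concatMap expand (cPref I c)))
    couples c with proj₁ (proj₂ matching) c
    ... | inj₁ (M₁≡nothing , M₂≡nothing) = inj₁ (M′-nothing M₁≡nothing , M′-nothing M₂≡nothing)
    ... | inj₂ (h₁ , h₂ , M₁≡h₁ , M₂≡h₂ , q∈)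
      with a , M′₁≡h₁a ← M′-just⁺ M₁≡h₁ | b , M′₂≡h₂b ← M′-just⁺ M₂≡h₂ =
          inj₂ ((h₁ , a) , (h₂ , b) , M′₁≡h₁a , M′₂≡h₂b , ∈-expanded⁺ a b q∈ a≢b)
      where
      a≢b : (h₁ , a) ≢ (h₂ , b)
      a≢b eq with () ← seat-occupant-unique M′₁≡h₁a (trans M′₂≡h₂b (cong just (sym eq)))

  no-BP1′ : ¬ B.BP1 M′
  no-BP1′ (s , (h , x) , (hx∈ , inj₁ M′s≡nothing) , admits′) =
    no-BP1 (s , h , (∈-cloned⁻ hx∈ , inj₁ (unseated⇒unassigned M′s≡nothing)) , project-admits _ admits′)
  no-BP1′ (s , (h , x) , (hx∈ , inj₂ ((h′ , y) , M′s≡h′y , better)) , admits′)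
    with Precedes-cloned⁻ (Before⇒Precedes better)
  ... | inj₁ h<h′ = no-BP1 (s , h , (∈-cloned⁻ hx∈ , inj₂ (h′ , seated⇒assigned M′s≡h′y , Precedes⇒Before h<h′)) ,
                            project-admits _ admits′)
  ... | inj₂ (refl , x<y) = lower-clone-rejects x y M′s≡h′y x<y admits′

  no-BP2′ : ¬ B.BP2 M′
  no-BP2′ (c , (hk , x) , (h₁ , a) , (h₂ , b) , M′₁≡ , M′₂≡ , inj₁ (better , admits′))
    with Precedes-expanded⁻ {cPref I c} (Before⇒Precedes better)
  ... | inj₁ q<q′ = no-BP2 (c , hk , h₁ , h₂ , seated⇒assigned M′₁≡ , seated⇒assigned M′₂≡ ,
                            inj₁ (Precedes⇒Before q<q′ , project-admits _ admits′))
  ... | inj₂ (refl , refl , inj₁ b<b) = <-irrefl refl b<b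
  ... | inj₂ (refl , refl , inj₂ (_ , x<a)) = lower-clone-rejects x a M′₁≡ x<a (FB.Admits-map M′ proj₂ admits′)
  no-BP2′ (c , (hk , x) , (h₁ , a) , (h₂ , b) , M′₁≡ , M′₂≡ , inj₂ (better , admits′))
    with Precedes-expanded⁻ {cPref I c} (Before⇒Precedes better)
  ... | inj₁ q<q′ = no-BP2 (c , hk , h₁ , h₂ , seated⇒assigned M′₁≡ , seated⇒assigned M′₂≡ ,
                            inj₂ (Precedes⇒Before q<q′ , project-admits _ admits′))
  ... | inj₂ (refl , refl , inj₁ x<b) = lower-clone-rejects x b M′₂≡ x<b (FB.Admits-map M′ proj₂ admits′)
  ... | inj₂ (refl , refl , inj₂ (_ , a<a)) = <-irrefl refl a<a

  load-trichotomy : ∀ n C → n + 2 ≤ C ⊎ suc n ≡ C ⊎ C ≤ n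
  load-trichotomy n C with <-cmp (suc n) C
  ... | tri< 1+n<C _ _ = inj₁ (≤-trans (≤-reflexive (+-comm n 2)) 1+n<C)
  ... | tri≈ _ 1+n≡C _ = inj₂ (inj₁ 1+n≡C)
  ... | tri> _ _ C<1+n = inj₂ (inj₂ (s≤s⁻¹ C<1+n))

  two-free-clones : ∀ {h} (x y : Fin (cap I h)) → x ≢ y → B.Under M′ (h , x) → B.Under M′ (h , y) →
                    A.load M h + 2 ≤ cap I h
  two-free-clones {h} x y x≢y free₁ free₂ = subst (λ n → n + 2 ≤ cap I h) (sym (load≡∑ h))
    (two-zeros⇒∑+2≤n _ x y (λ x → clone-load≤1 (h , x)) x≢y (n<1⇒n≡0 free₁) (n<1⇒n≡0 free₂))

  same-hospital-BP3 : ∀ c {h} (x y : Fin (cap I h)) → M (mem₁ I c) ≢ just h → M (mem₂ I c) ≢ just h →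
                      PrefersTo (cPref I c) (h , h) (A.pairOf M c) → x ≢ y →
                      Admits′ M′ (h , x) (Before (hPref I h) (mem₁ I c)) →
                      Admits′ M′ (h , y) (Before (hPref I h) (mem₂ I c)) → A.BP3 M
  same-hospital-BP3 c {h} x y M₁≢h M₂≢h prefers x≢y admits₁ admits₂
    with load-trichotomy (A.load M h) (cap I h) | admits₁ | admits₂
  ... | inj₁ two-free | _ | _ = c , h , h , M₁≢h , M₂≢h , prefers , inj₂ (inj₁ (refl , two-free))
  ... | inj₂ (inj₁ one-free) | inj₂ (r , M′r≡ , r<₁) | _ =
        c , h , h , M₁≢h , M₂≢h , prefers ,
        inj₂ (inj₂ (inj₁ (refl , one-free , r , seated⇒assigned M′r≡ , inj₁ r<₁)))
  ... | inj₂ (inj₁ one-free) | inj₁ _ | inj₂ (r , M′r≡ , r<₂) =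
        c , h , h , M₁≢h , M₂≢h , prefers ,
        inj₂ (inj₂ (inj₁ (refl , one-free , r , seated⇒assigned M′r≡ , inj₂ r<₂)))
  ... | inj₂ (inj₁ one-free) | inj₁ free₁ | inj₁ free₂ =
        ⊥-elim (<-irrefl refl (subst (suc (suc (A.load M h)) ≤_) (sym one-free)
                 (≤-trans (≤-reflexive (+-comm 2 (A.load M h))) (two-free-clones x y x≢y free₁ free₂))))
  ... | inj₂ (inj₂ full) | inj₁ free₁ | _ = ⊥-elim (<⇒≱ (free-clone⇒Under free₁) full)
  ... | inj₂ (inj₂ full) | inj₂ _ | inj₁ free₂ = ⊥-elim (<⇒≱ (free-clone⇒Under free₂) full)
  ... | inj₂ (inj₂ full) | inj₂ (rs , M′rs≡ , rs<₁) | inj₂ (rt , M′rt≡ , rt<₂) =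
        c , h , h , M₁≢h , M₂≢h , prefers ,
        inj₂ (inj₂ (inj₂ (refl , full , rs , seated⇒assigned M′rs≡ , rs<₁ ,
                          rt , seated⇒assigned M′rt≡ , rt≢rs , rt<₂)))
    where
    rt≢rs : rt ≢ rs
    rt≢rs refl with refl ← trans (sym M′rs≡) M′rt≡ = x≢y refl

  projected-BP3 : ∀ c {hk hl} (x : Fin (cap I hk)) (y : Fin (cap I hl)) →
                  M (mem₁ I c) ≢ just hk → M (mem₂ I c) ≢ just hl →
                  PrefersTo (cPref I c) (hk , hl) (A.pairOf M c) → (hk , x) ≢ (hl , y) →
                  Admits′ M′ (hk , x) (Before (hPref I hk) (mem₁ I c)) →
                  Admits′ M′ (hl , y) (Before (hPref I hl) (mem₂ I c)) → A.BP3 M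
  projected-BP3 c {hk} {hl} x y M₁≢hk M₂≢hl prefers x≢y admits₁ admits₂ with hk ≟H hl
  ... | no hk≢hl = c , hk , hl , M₁≢hk , M₂≢hl , prefers ,
                   inj₁ (hk≢hl , project-admits _ admits₁ , project-admits _ admits₂)
  ... | yes refl = same-hospital-BP3 c x y M₁≢hk M₂≢hl prefers (x≢y ∘ cong (hk ,_)) admits₁ admits₂

  -- If the assignee that h_l would drop for r_j is r_i itself, then h_l = h_k and the
  -- clone h_{k,x} supplies the free post or another resident worse than r_j.
  partner-excluded₂ : ∀ c {hk hl} {x a : Fin (cap I hk)} {y : Fin (cap I hl)} →
                      M′ (mem₁ I c) ≡ just (hk , a) → M′ (mem₁ I c) ≢ just (hk , x) →
                      Admits′ M′ (hk , x) (Before (hPref I hk) (mem₁ I c)) →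
                      Admits′ M′ (hl , y) (Before (hPref I hl) (mem₂ I c)) →
                      Admits M hl (λ r → r ≢ mem₁ I c × Before (hPref I hl) (mem₂ I c) r)
  partner-excluded₂ c M′₁≡ M′₁≢ admits₁ (inj₁ free₂) = inj₁ (free-clone⇒Under free₂)
  partner-excluded₂ c {hk} M′₁≡ M′₁≢ admits₁ (inj₂ (r , M′r≡ , r<₂)) with r ≟R mem₁ I c
  ... | no r≢₁ = inj₂ (r , seated⇒assigned M′r≡ , r≢₁ , r<₂)
  ... | yes refl with refl ← trans (sym M′₁≡) M′r≡ with admits₁
  ...   | inj₁ free₁ = inj₁ (free-clone⇒Under free₁)
  ...   | inj₂ (r′ , M′r′≡ , ₁<r′) =
          inj₂ (r′ , seated⇒assigned M′r′≡ , (λ { refl → M′₁≢ M′r′≡ }) ,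
                Precedes⇒Before (Precedes-trans (hUnique hk) (Before⇒Precedes r<₂) (Before⇒Precedes ₁<r′)))

  partner-excluded₁ : ∀ c {hk hl} {x : Fin (cap I hk)} {y b : Fin (cap I hl)} →
                      M′ (mem₂ I c) ≡ just (hl , b) → M′ (mem₂ I c) ≢ just (hl , y) →
                      Admits′ M′ (hk , x) (Before (hPref I hk) (mem₁ I c)) →
                      Admits′ M′ (hl , y) (Before (hPref I hl) (mem₂ I c)) →
                      Admits M hk (λ r → r ≢ mem₂ I c × Before (hPref I hk) (mem₁ I c) r)
  partner-excluded₁ c M′₂≡ M′₂≢ (inj₁ free₁) admits₂ = inj₁ (free-clone⇒Under free₁)
  partner-excluded₁ c {hk} M′₂≡ M′₂≢ (inj₂ (r , M′r≡ , r<₁)) admits₂ with r ≟R mem₂ I c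
  ... | no r≢₂ = inj₂ (r , seated⇒assigned M′r≡ , r≢₂ , r<₁)
  ... | yes refl with refl ← trans (sym M′₂≡) M′r≡ with admits₂
  ...   | inj₁ free₂ = inj₁ (free-clone⇒Under free₂)
  ...   | inj₂ (r′ , M′r′≡ , ₂<r′) =
          inj₂ (r′ , seated⇒assigned M′r′≡ , (λ { refl → M′₂≢ M′r′≡ }) ,
                Precedes⇒Before (Precedes-trans (hUnique hk) (Before⇒Precedes r<₁) (Before⇒Precedes ₂<r′)))

  no-BP3′ : ¬ B.BP3 M′
  no-BP3′ (c , _ , _ , _ , _ , (p∈ , _) , inj₂ (inj₁ (same , _))) = proj₂ (∈-expanded⁻ {cPref I c} p∈) same
  no-BP3′ (c , _ , _ , _ , _ , (p∈ , _) , inj₂ (inj₂ (inj₁ (same , _)))) =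
    proj₂ (∈-expanded⁻ {cPref I c} p∈) same
  no-BP3′ (c , _ , _ , _ , _ , (p∈ , _) , inj₂ (inj₂ (inj₂ (same , _)))) =
    proj₂ (∈-expanded⁻ {cPref I c} p∈) same
  no-BP3′ (c , (hk , x) , (hl , y) , M′₁≢ , M′₂≢ , (p∈ , current) , inj₁ (x≢y , admits₁ , admits₂)) =
    by-current current
    where
    q∈ : (hk , hl) ∈ cPref I c
    q∈ = proj₁ (∈-expanded⁻ {cPref I c} p∈)

    blocks : M (mem₁ I c) ≢ just hk → M (mem₂ I c) ≢ just hl →
             (A.pairOf M c ≡ nothing) ⊎ (∃ λ q → A.pairOf M c ≡ just q × Before (cPref I c) (hk , hl) q) → ⊥
    blocks M₁≢ M₂≢ current = no-BP3 (projected-BP3 c x y M₁≢ M₂≢ (q∈ , current) x≢y admits₁ admits₂)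

    by-current : (B.pairOf M′ c ≡ nothing)
                   ⊎ (∃ λ q′ → B.pairOf M′ c ≡ just q′ × Before (cPref clone c) ((hk , x) , (hl , y)) q′) → ⊥
    by-current (inj₁ pair′≡nothing)
      with M′₁≡nothing , M′₂≡nothing ← FB.pairOf-nothing⁻ M′ matching′ c pair′≡nothing =
      blocks (λ M₁≡ → case trans (sym M₁≡) (unseated⇒unassigned M′₁≡nothing) of λ ())
             (λ M₂≡ → case trans (sym M₂≡) (unseated⇒unassigned M′₂≡nothing) of λ ())
             (inj₁ (FA.pairOf-nothing⁺ M c (unseated⇒unassigned M′₁≡nothing)))
    by-current (inj₂ (((h₁ , a) , (h₂ , b)) , pair′≡ , better))
      with M′₁≡ , M′₂≡ ← FB.pairOf-just⁻ M′ c pair′≡ | Precedes-expanded⁻ {cPref I c} (Before⇒Precedes better)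
    ... | inj₂ (refl , refl , inj₁ y<b) = lower-clone-rejects y b M′₂≡ y<b admits₂
    ... | inj₂ (refl , refl , inj₂ (y≡b , _)) =
          M′₂≢ (subst (λ z → M′ (mem₂ I c) ≡ just (hl , z)) (sym (FP.toℕ-injective y≡b)) M′₂≡)
    ... | inj₁ q<q′ = by-hospitals (hk ≟H h₁) (hl ≟H h₂)
      where
      by-hospitals : Dec (hk ≡ h₁) → Dec (hl ≡ h₂) → ⊥
      by-hospitals (yes refl) (yes refl) = Precedes-irrefl (cUnique c) q<q′
      by-hospitals (yes refl) (no _) =
        no-BP2 (c , hl , hk , h₂ , seated⇒assigned M′₁≡ , seated⇒assigned M′₂≡ ,
                inj₂ (Precedes⇒Before q<q′ , partner-excluded₂ c M′₁≡ M′₁≢ admits₁ admits₂))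
      by-hospitals (no _) (yes refl) =
        no-BP2 (c , hk , h₁ , hl , seated⇒assigned M′₁≡ , seated⇒assigned M′₂≡ ,
                inj₁ (Precedes⇒Before q<q′ , partner-excluded₁ c M′₂≡ M′₂≢ admits₁ admits₂))
      by-hospitals (no hk≢h₁) (no hl≢h₂) =
        blocks (λ M₁≡ → hk≢h₁ (MaybeP.just-injective (trans (sym M₁≡) (seated⇒assigned M′₁≡))))
               (λ M₂≡ → hl≢h₂ (MaybeP.just-injective (trans (sym M₂≡) (seated⇒assigned M′₂≡))))
               (inj₂ ((h₁ , h₂) , FA.pairOf-just⁺ M c (seated⇒assigned M′₁≡) (seated⇒assigned M′₂≡) ,
                      Precedes⇒Before q<q′))

  stable′ : B.MMStable M′
  stable′ = matching′ , no-BP1′ , no-BP2′ , no-BP3′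

HasMMStable⇔HasMMStable-clone : ∀ {H} (_≟H_ : DecidableEquality H) (I : Instance H) → Valid I →
  Matchings.HasMMStable _≟H_ I ⇔ Matchings.HasMMStable (Cloning._≟CH_ _≟H_ I) (Cloning.clone _≟H_ I)
HasMMStable⇔HasMMStable-clone _≟H_ I V = mk⇔
  (λ (M , stable) → Seating.M′ _≟H_ I V M stable , Seating.stable′ _≟H_ I V M stable)
  (λ (M′ , stable′) → Projection.M _≟H_ I M′ stable′ , Projection.stable _≟H_ I M′ stable′)

lemma14 : ∀ {nh} (I : Instance (Fin nh)) → Valid I
    → Matchings.HasMMStable _≟_ I ⇔ Matchings.HasMMStable (Cloning._≟CH_ _≟_ I) (Cloning.clone _≟_ I)
lemma14 = HasMMStable⇔HasMMStable-clone _≟_
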